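{- Let $G=(V,E,w)$ be a directed graph with integer edge weights $w:E\to\mathbb{Z}$ that is restricted and strongly connected (consists of a single strongly connected component). Then $\kappa(G)\le \mathrm{diam}(G_{\geq 0})$.
   Context: For a cycle $C=e_1,\dots,e_\ell$ in $G$, its mean is $\sum_{i=1}^{\ell} w(e_i)/\ell$; the minimum cycle mean of $G$ is the minimum mean over all cycles of $G$. The graph $G$ is called restricted if $w(e)\ge -1$ for every $e\in E$ and the minimum cycle mean of $G$ is at least $1$. The quantity $\kappa(G)$ is the largest number of negative-weight edges contained in any simple path of $G$ whose total weight is non-positive. $G_{\geq 0}$ denotes the graph $G$ with modified weights $w_{\geq 0}(e)=\max\{w(e),0\}$, and $\mathrm{diam}(G_{\geq 0})$ is the maximum, over ordered pairs of vertices $(u,v)$, of the shortest-path distance from $u$ to $v$ in $G_{\geq 0}$. -}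

module Defs where

open import Data.Nat as ℕ using (ℕ; zero; suc)
open import Data.Integer as ℤ using (ℤ; +_; _+_; _⊔_; _≤_; _<_)
open import Data.Fin using (Fin)
open import Data.List using (List; []; _∷_)
open import Data.List.Relation.Unary.Unique.Propositional using (Unique)
open import Data.Product using (Σ; _×_; ∃; ∃-syntax; _,_)
open import Relation.Binary.PropositionalEquality using (_≡_)
open import Relation.Nullary using (yes; no)

record Graph : Set where
  field
    n   : ℕ
    m   : ℕ
    src : Fin m → Fin n
    tgt : Fin m → Fin n
    w   : Fin m → ℤ

module _ (G : Graph) where
  open Graph G

  data Walk : Fin n → Fin n → Set where
    nil  : ∀ {u} → Walk u u
    cons : ∀ {u v} (e : Fin m) → src e ≡ u → Walk (tgt e) v → Walk u v

  len : ∀ {u v} → Walk u v → ℕ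
  len nil          = 0
  len (cons _ _ p) = suc (len p)

  weight : ∀ {u v} → Walk u v → ℤ
  weight nil          = + 0
  weight (cons e _ p) = w e + weight p

  -- weight in G_{≥0}: sum of max{w(e),0}
  weight≥0 : ∀ {u v} → Walk u v → ℤ
  weight≥0 nil          = + 0
  weight≥0 (cons e _ p) = (w e ⊔ + 0) + weight≥0 p

  negCount : ∀ {u v} → Walk u v → ℕ
  negCount nil = 0
  negCount (cons e _ p) with w e ℤ.<? + 0
  ... | yes _ = suc (negCount p)
  ... | no  _ = negCount p

  targets : ∀ {u v} → Walk u v → List (Fin n)
  targets nil          = []
  targets (cons e _ p) = tgt e ∷ targets p

  vertices : ∀ {u v} → Walk u v → List (Fin n)
  vertices {u} p = u ∷ targets p

  IsSimplePath : ∀ {u v} → Walk u v → Set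
  IsSimplePath p = Unique (vertices p)

  -- (simple) cycle: closed walk with at least one edge, no vertex repeated
  -- except that the last vertex equals the first
  IsCycle : ∀ {u} → Walk u u → Set
  IsCycle c = (1 ℕ.≤ len c) × Unique (targets c)

  -- every cycle has mean weight(C)/len(C) ≥ 1, i.e. weight(C) ≥ len(C)
  MinCycleMeanAtLeast1 : Set
  MinCycleMeanAtLeast1 = ∀ u (c : Walk u u) → IsCycle c → + len c ≤ weight c

  Restricted : Set
  Restricted = (∀ e → ℤ.-[1+ 0 ] ≤ w e) × MinCycleMeanAtLeast1

  StronglyConnected : Set
  StronglyConnected = ∀ u v → Walk u v

  -- K = κ(G): max number of negative edges on a simple path with weight ≤ 0
  IsKappa : ℕ → Set
  IsKappa K =
    (∃[ u ] ∃[ v ] Σ (Walk u v) λ p → IsSimplePath p × weight p ≤ + 0 × negCount p ≡ K)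
    × (∀ u v (p : Walk u v) → IsSimplePath p → weight p ≤ + 0 → negCount p ℕ.≤ K)

  IsDist≥0 : Fin n → Fin n → ℤ → Set
  IsDist≥0 u v d = (Σ (Walk u v) λ p → weight≥0 p ≡ d) × (∀ (p : Walk u v) → d ≤ weight≥0 p)

  IsDiam≥0 : ℤ → Set
  IsDiam≥0 D = (∀ u v → ∃[ d ] (IsDist≥0 u v d × d ≤ D)) × (∃[ u ] ∃[ v ] IsDist≥0 u v D)

{-# OPTIONS --safe #-}
-- Let P be a simple path of weight ≤ 0 with κ(G) negative edges, from u to v, and Q a shortest
-- v–u path in G_{≥0}. Under the shifted weights w − 1 every cycle is non-negative, and loop
-- erasure shows that then every closed walk is non-negative too; hence the closed walk P Q has
-- weight at least its length, and
--   κ(G) ≤ |P| ≤ |P Q| ≤ w(P Q) = w(P) + w(Q) ≤ 0 + w_{≥0}(Q) ≤ diam(G_{≥0}).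
module Submission where

open import Defs
open import Data.Nat using (ℕ)
open import Data.Integer using (ℤ; +_; _≤_)

import Data.Nat as ℕ
import Data.Nat.Properties as ℕ
import Data.Integer as ℤ
import Data.Integer.Properties as ℤ
open import Data.Integer.Tactic.RingSolver using (solve-∀)
open import Data.Fin using (Fin)
import Data.Fin.Properties as Fin
open import Data.List using (_∷_; _++_)
open import Data.List.Relation.Unary.All using (All; []; _∷_)
open import Data.List.Relation.Unary.All.Properties using (++⁻ˡ; ¬Any⇒All¬; All¬⇒¬Any)
open import Data.List.Relation.Unary.Any using (here; there)
open import Data.List.Relation.Unary.AllPairs using ([]; _∷_)
open import Data.List.Membership.Propositional using (_∈_)
open import Data.Product using (Σ; _×_; _,_)
open import Data.Empty using (⊥-elim)
open import Function using (_∘_)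
open import Relation.Binary.PropositionalEquality
open import Relation.Nullary using (yes; no)

module WalkProperties (G : Graph) where
  open Graph G

  private variable a b c : Fin n

  _++ʷ_ : Walk G a b → Walk G b c → Walk G a c
  nil           ++ʷ q = q
  cons e eq p   ++ʷ q = cons e eq (p ++ʷ q)

  len-++ʷ : (p : Walk G a b) (q : Walk G b c) → len G (p ++ʷ q) ≡ len G p ℕ.+ len G q
  len-++ʷ nil           q = refl
  len-++ʷ (cons e _ p)  q = cong ℕ.suc (len-++ʷ p q)

  weight-++ʷ : (p : Walk G a b) (q : Walk G b c) →
               weight G (p ++ʷ q) ≡ weight G p ℤ.+ weight G q
  weight-++ʷ nil           q = sym (ℤ.+-identityˡ _)
  weight-++ʷ (cons e _ p)  q =
    trans (cong (ℤ._+_ (w e)) (weight-++ʷ p q)) (sym (ℤ.+-assoc (w e) _ _))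

  targets-++ʷ : (p : Walk G a b) (q : Walk G b c) →
                targets G (p ++ʷ q) ≡ targets G p ++ targets G q
  targets-++ʷ nil           q = refl
  targets-++ʷ (cons e _ p)  q = cong (tgt e ∷_) (targets-++ʷ p q)

  vertices-++ʷ : (p : Walk G a b) (q : Walk G b c) →
                 vertices G (p ++ʷ q) ≡ vertices G p ++ targets G q
  vertices-++ʷ {a} p q = cong (a ∷_) (targets-++ʷ p q)

  weight≤weight≥0 : (p : Walk G a b) → weight G p ≤ weight≥0 G p
  weight≤weight≥0 nil           = ℤ.≤-refl
  weight≤weight≥0 (cons e _ p)  = ℤ.+-mono-≤ (ℤ.i≤i⊔j (w e) (+ 0)) (weight≤weight≥0 p)

  negCount≤len : (p : Walk G a b) → negCount G p ℕ.≤ len G p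
  negCount≤len nil = ℕ.z≤n
  negCount≤len (cons e _ p) with w e ℤ.<? + 0
  ... | yes _ = ℕ.s≤s (negCount≤len p)
  ... | no  _ = ℕ.m≤n⇒m≤1+n (negCount≤len p)

  last∈vertices : (p : Walk G a b) → b ∈ vertices G p
  last∈vertices nil           = here refl
  last∈vertices (cons _ _ p)  = there (last∈vertices p)

module LoopErasure (G : Graph) (f : Fin (Graph.m G) → ℤ) where
  open Graph G
  open WalkProperties G
  open import Data.List.Membership.DecPropositional (Fin._≟_ {n}) using (_∈?_)

  private variable a b c x : Fin n

  weightWith : Walk G a b → ℤ
  weightWith nil           = + 0
  weightWith (cons e _ p)  = f e ℤ.+ weightWith p

  weightWith-++ʷ : (p : Walk G a b) (q : Walk G b c) →
                   weightWith (p ++ʷ q) ≡ weightWith p ℤ.+ weightWith q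
  weightWith-++ʷ nil           q = sym (ℤ.+-identityˡ _)
  weightWith-++ʷ (cons e _ p)  q =
    trans (cong (ℤ._+_ (f e)) (weightWith-++ʷ p q)) (sym (ℤ.+-assoc (f e) _ _))

  record Split (x : Fin n) (s : Walk G a b) : Set where
    field
      prefix        : Walk G a x
      suffix        : Walk G x b
      splits        : s ≡ prefix ++ʷ suffix
      prefix-simple : IsSimplePath G prefix
      suffix-simple : IsSimplePath G suffix

  split : (s : Walk G a b) → IsSimplePath G s → x ∈ vertices G s → Split x s
  split s s-simple (here refl) = record
    { prefix = nil ; suffix = s ; splits = refl
    ; prefix-simple = [] ∷ [] ; suffix-simple = s-simple }
  split {a} (cons e eq q) (a∉q ∷ q-simple) (there x∈q) = record
    { prefix = cons e eq S.prefix ; suffix = S.suffix ; splits = cong (cons e eq) S.splits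
    ; prefix-simple = a∉prefix ∷ S.prefix-simple ; suffix-simple = S.suffix-simple }
    where
      module S = Split (split q q-simple x∈q)
      a∉prefix : All (a ≢_) (vertices G S.prefix)
      a∉prefix = ++⁻ˡ (vertices G S.prefix)
        (subst (All (a ≢_)) (trans (cong (vertices G) S.splits) (vertices-++ʷ S.prefix S.suffix)) a∉q)

  CyclesNonNegative : Set
  CyclesNonNegative = ∀ u (c : Walk G u u) → IsCycle G c → + 0 ≤ weightWith c

  module _ (cycles≥0 : CyclesNonNegative) where

    loopErase : (p : Walk G a b) →
                Σ (Walk G a b) λ s → IsSimplePath G s × weightWith s ≤ weightWith p
    loopErase nil = nil , [] ∷ [] , ℤ.≤-refl
    loopErase {a} (cons e eq q) with loopErase q
    ... | s , s-simple , s≤q with a ∈? vertices G s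
    ... | no a∉s  = cons e eq s , ¬Any⇒All¬ _ a∉s ∷ s-simple , ℤ.+-monoʳ-≤ (f e) s≤q
    ... | yes a∈s = S.suffix , S.suffix-simple , ℤ.≤-trans suffix≤ (ℤ.+-monoʳ-≤ (f e) s≤q)
      where
        module S = Split (split s s-simple a∈s)
        open ℤ.≤-Reasoning
        loop : Walk G a a
        loop = cons e eq S.prefix
        loop-cycle : IsCycle G loop
        loop-cycle = ℕ.s≤s ℕ.z≤n , S.prefix-simple
        suffix≤ : weightWith S.suffix ≤ f e ℤ.+ weightWith s
        suffix≤ = begin
          weightWith S.suffix                      ≡⟨ ℤ.+-identityˡ _ ⟨
          + 0 ℤ.+ weightWith S.suffix              ≤⟨ ℤ.+-monoˡ-≤ _ (cycles≥0 a loop loop-cycle) ⟩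
          weightWith loop ℤ.+ weightWith S.suffix  ≡⟨ weightWith-++ʷ loop S.suffix ⟨
          weightWith (loop ++ʷ S.suffix)           ≡⟨ cong (weightWith ∘ cons e eq) S.splits ⟨
          f e ℤ.+ weightWith s                     ∎

    closedWalk-nonNegative : (c : Walk G a a) → + 0 ≤ weightWith c
    closedWalk-nonNegative c with loopErase c
    ... | nil        , _       , s≤c = s≤c
    ... | cons _ _ q , a∉q ∷ _ , _   = ⊥-elim (All¬⇒¬Any a∉q (last∈vertices q))

module MinCycleMean (G : Graph) where
  open Graph G
  open LoopErasure G (λ e → w e ℤ.- + 1)

  private variable a b : Fin n

  weightWith≡weight-len : (p : Walk G a b) → weightWith p ≡ weight G p ℤ.- + len G p
  weightWith≡weight-len nil          = refl
  weightWith≡weight-len (cons e _ p) =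
    trans (cong (ℤ._+_ (w e ℤ.- + 1)) (weightWith≡weight-len p))
          (regroup (w e) (weight G p) (+ len G p))
    where
      regroup : ∀ x y l → (x ℤ.- + 1) ℤ.+ (y ℤ.- l) ≡ (x ℤ.+ y) ℤ.- (+ 1 ℤ.+ l)
      regroup = solve-∀

  len≤weight-closedWalk : MinCycleMeanAtLeast1 G → (c : Walk G a a) → + len G c ≤ weight G c
  len≤weight-closedWalk minMean≥1 c = ℤ.0≤i-j⇒j≤i
    (subst (+ 0 ≤_) (weightWith≡weight-len c) (closedWalk-nonNegative cycles≥0 c))
    where
      cycles≥0 : CyclesNonNegative
      cycles≥0 u c c-cycle = subst (+ 0 ≤_) (sym (weightWith≡weight-len c))
        (ℤ.i≤j⇒0≤j-i (minMean≥1 u c c-cycle))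

mainTheorem1 : (G : Graph) → Restricted G → StronglyConnected G →
    (K : ℕ) (D : ℤ) → IsKappa G K → IsDiam≥0 G D → + K ≤ D
mainTheorem1 G (_ , minMean≥1) _ K D ((u , v , P , _ , wP≤0 , negP≡K) , _) (dist , _)
  with dist v u
... | d , ((Q , w≥0Q≡d) , _) , d≤D = begin
    + K                              ≡⟨ cong +_ negP≡K ⟨
    + negCount G P                   ≤⟨ ℤ.+≤+ (negCount≤len P) ⟩
    + len G P                        ≤⟨ ℤ.+≤+ (ℕ.m≤m+n (len G P) (len G Q)) ⟩
    + (len G P ℕ.+ len G Q)          ≡⟨ cong +_ (len-++ʷ P Q) ⟨
    + len G (P ++ʷ Q)                ≤⟨ len≤weight-closedWalk minMean≥1 (P ++ʷ Q) ⟩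
    weight G (P ++ʷ Q)               ≡⟨ weight-++ʷ P Q ⟩
    weight G P ℤ.+ weight G Q        ≤⟨ ℤ.+-mono-≤ wP≤0 (weight≤weight≥0 Q) ⟩
    + 0 ℤ.+ weight≥0 G Q             ≡⟨ ℤ.+-identityˡ _ ⟩
    weight≥0 G Q                     ≡⟨ w≥0Q≡d ⟩
    d                                ≤⟨ d≤D ⟩
    D                                ∎
  where
    open ℤ.≤-Reasoning
    open WalkProperties G
    open MinCycleMean G
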